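{- There is a function $\varepsilon:\mathbb{Z}_{>0}\to\mathbb{R}$ with $\varepsilon(d)\to 0$ as $d\to\infty$ such that $R_f(d)\le d^{2+\varepsilon(d)}$ for all integers $d>0$. (In short, $R_f(d)\le d^{2+o(1)}$.)
   Context: For an integer $n\ge 1$, ${\overset{\leftrightarrow}{K}}_n$ denotes the complete bidirected graph on $n$ vertices: for every pair of distinct vertices $u,v$ it has both directed edges $(u,v)$ and $(v,u)$. For an integer $d>0$ and $[d]=\{1,\dots,d\}$, a $d$-labeling of ${\overset{\leftrightarrow}{K}}_n$ assigns to every directed edge $e$ a function $\ell_e:[d]\to[d]$. A cycle means a simple directed cycle. If a cycle has edges $e_1,\dots,e_k$ in this order with labels $f_1,\dots,f_k$, it is a fixed-point cycle if the map $x\mapsto f_k(f_{k-1}(\cdots f_1(x)\cdots))$ has a fixed point in $[d]$ (this does not depend on the choice of starting edge). A labeling is fixed-point-free if there is no fixed-point cycle. $R_f(d)$ is the largest $n$ such that there exists a $d$-labeling of ${\overset{\leftrightarrow}{K}}_n$ with no fixed-point cycle. -}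

module Defs where

open import Data.Nat using (ℕ; _≤_; _^_; _*_; _+_)
open import Data.Fin using (Fin)
open import Data.List using (List; []; _∷_; _++_; [_]; length)
open import Data.List.Relation.Unary.Unique.Propositional using (Unique)
open import Data.Product using (Σ; _×_)
open import Relation.Binary.PropositionalEquality using (_≡_)
open import Relation.Nullary using (¬_)

-- A d-labeling of the complete bidirected graph on vertex set Fin n
-- (vertices = Fin n, [d] = Fin d).  lab u v is the label of the directed
-- edge (u,v); the values on the diagonal u = v are irrelevant (no loops,
-- and cycles below are simple, so they never use them).
Labeling : ℕ → ℕ → Set
Labeling d n = Fin n → Fin n → Fin d → Fin d

pathMap : ∀ {d n} → Labeling d n → Fin n → List (Fin n) → Fin d → Fin d
pathMap lab cur []       x = x
pathMap lab cur (w ∷ ws) x = pathMap lab w ws (lab cur w x)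

-- The map x ↦ f_k(…f_1(x)…) of the closed walk v₀ → v₁ → … → v_{k-1} → v₀,
-- where vs = v₁ … v_{k-1}.
cycleMap : ∀ {d n} → Labeling d n → Fin n → List (Fin n) → Fin d → Fin d
cycleMap lab v₀ vs = pathMap lab v₀ (vs ++ [ v₀ ])

-- A simple directed cycle v₀ → v₁ → … → v_{k-1} → v₀ : distinct vertices,
-- at least 2 of them (k ≥ 2; 2-cycles u → v → u exist in the bidirected graph).
IsCycle : ∀ {n} → Fin n → List (Fin n) → Set
IsCycle v₀ vs = Unique (v₀ ∷ vs) × (1 ≤ length vs)

FixedPointCycle : ∀ {d n} → Labeling d n → Fin n → List (Fin n) → Set
FixedPointCycle {d} lab v₀ vs = IsCycle v₀ vs × Σ (Fin d) (λ x → cycleMap lab v₀ vs x ≡ x)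

FixedPointFree : ∀ {d n} → Labeling d n → Set
FixedPointFree {n = n} lab = ∀ (v₀ : Fin n) (vs : List (Fin n)) → ¬ FixedPointCycle lab v₀ vs

{-# OPTIONS --safe #-}
-- Fix a fixed-point-free d-labeling ℓ of the complete bidirected graph on n vertices and a
-- colouring c of the vertices with colours in [d]; call the edge (u, w) consistent if
-- ℓ_{uw}(c u) = c w.  If every vertex had a consistent out-edge, following such edges would
-- close a simple cycle whose composite label fixes the colour of its first vertex.  So every
-- colouring has a sink, a vertex without consistent out-edges.  A given vertex is a sink of
-- exactly d (d - 1)^(n - 1) colourings, hence d^n ≤ n d (d - 1)^(n - 1), that is
-- (1 + 1/(d - 1))^(n - 1) ≤ n.  As (1 + 1/a)^a ≥ 2, this forces n ≤ d², so R_f(d) ≤ d².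
module Submission where

open import Defs
open import Data.Bool using (if_then_else_)
open import Data.Fin using (Fin; zero; suc; _≟_)
open import Data.Fin.Properties using (injective⇒≤; all?; any?; ¬∀⟶∃¬)
open import Data.List using (List; []; _∷_; _++_; [_]; length; lookup)
open import Data.List.Membership.Propositional using (_∈_; _∉_)
open import Data.List.Membership.Propositional.Properties using (∈-lookup)
open import Data.List.Properties using (length-++)
import Data.List.Relation.Unary.All as All
open import Data.List.Relation.Unary.Any using (here; there)
open import Data.List.Relation.Unary.Unique.Propositional using (Unique; []; _∷_)
open import Data.List.Relation.Unary.Unique.Propositional.Properties using (++⁺)
open import Data.Nat using (ℕ; zero; suc; _≤_; _<_; _≤′_; ≤′-refl; ≤′-step; z≤n; s≤s; _+_; _*_; _^_; pred; NonZero; >-nonZero)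
open import Data.Nat.Properties hiding (_≟_)
open import Data.Nat.Tactic.RingSolver using (solve-∀)
open import Data.Product using (Σ; ∃; ∃₂; _×_; _,_)
open import Data.Vec.Functional as Vector using (Vector)
open import Function using (_∘_; id; Injective)
open import Relation.Binary.PropositionalEquality using (_≡_; _≢_; refl; sym; trans; cong; subst; module ≡-Reasoning)
open import Relation.Nullary using (¬_; Dec; yes; no; does; ¬?; contradiction)
open import Relation.Nullary.Decidable using (_×-dec_; from-yes)

open import Algebra.Properties.Semiring.Sum +-*-semiring
  using (sum; sum-syntax; sum-cong-≗; sum-replicate-zero; ∑-comm; *-distribˡ-sum; *-distribʳ-sum)
open import Algebra.Properties.Monoid.Sum *-1-monoid
  using () renaming (sum to product; sum-cong-≗ to product-cong-≗)

sum-mono-≤ : ∀ {m} {f g : Vector ℕ m} → (∀ i → f i ≤ g i) → sum f ≤ sum g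
sum-mono-≤ {zero}  f≤g = z≤n
sum-mono-≤ {suc m} f≤g = +-mono-≤ (f≤g zero) (sum-mono-≤ (f≤g ∘ suc))

≤-sum : ∀ {m} (f : Vector ℕ m) i → f i ≤ sum f
≤-sum f zero    = m≤m+n (f zero) _
≤-sum f (suc i) = ≤-trans (≤-sum (f ∘ suc) i) (m≤n+m _ (f zero))

sum-const : ∀ m k → ∑[ i < m ] k ≡ m * k
sum-const zero    k = refl
sum-const (suc m) k = cong (k +_) (sum-const m k)

product-const : ∀ m k → product {m} (λ _ → k) ≡ k ^ m
product-const zero    k = refl
product-const (suc m) k = cong (k *_) (product-const m k)

1≤product : ∀ {m} (f : Vector ℕ m) → (∀ i → 1 ≤ f i) → 1 ≤ product f
1≤product {zero}  f 1≤f = ≤-refl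
1≤product {suc m} f 1≤f = *-mono-≤ (1≤f zero) (1≤product (f ∘ suc) (1≤f ∘ suc))

product-except : ∀ {m} (u : Fin m) k →
                 product (λ w → if does (w ≟ u) then 1 else k) ≡ k ^ pred m
product-except {suc m}       zero    k = trans (+-identityʳ _) (product-const m k)
product-except {suc (suc m)} (suc u) k = cong (k *_) (product-except u k)

𝟙 : ∀ {p} {P : Set p} → Dec P → ℕ
𝟙 p? = if does p? then 1 else 0

1≤𝟙 : ∀ {p} {P : Set p} (p? : Dec P) → P → 1 ≤ 𝟙 p?
1≤𝟙 (yes _) _ = ≤-refl
1≤𝟙 (no ¬p) p = contradiction p ¬p

∑-𝟙≡ : ∀ {m} (x : Fin m) → ∑[ y < m ] 𝟙 (y ≟ x) ≡ 1
∑-𝟙≡ {suc m} zero    = cong suc (sum-replicate-zero m)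
∑-𝟙≡ {suc m} (suc x) = ∑-𝟙≡ x

∑-𝟙≢ : ∀ {m} (x : Fin (suc m)) → ∑[ y < suc m ] 𝟙 (¬? (y ≟ x)) ≡ m
∑-𝟙≢ {m}     zero    = trans (sum-const m 1) (*-identityʳ m)
∑-𝟙≢ {suc m} (suc x) = cong suc (∑-𝟙≢ x)

module _ {d : ℕ} where

  ∑-vectors : ∀ n → (Vector (Fin d) n → ℕ) → ℕ
  ∑-vectors zero    F = F Vector.[]
  ∑-vectors (suc n) F = ∑[ x < d ] ∑-vectors n (λ c → F (x Vector.∷ c))

  ∑-vectors-mono : ∀ n {F G : Vector (Fin d) n → ℕ} → (∀ c → F c ≤ G c) → ∑-vectors n F ≤ ∑-vectors n G
  ∑-vectors-mono zero    F≤G = F≤G _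
  ∑-vectors-mono (suc n) F≤G = sum-mono-≤ (λ x → ∑-vectors-mono n (λ c → F≤G (x Vector.∷ c)))

  ∑-vectors-1 : ∀ n → ∑-vectors n (λ _ → 1) ≡ d ^ n
  ∑-vectors-1 zero    = refl
  ∑-vectors-1 (suc n) = trans (sum-cong-≗ {d} (λ _ → ∑-vectors-1 n)) (sum-const d (d ^ n))

  ∑-vectors-*ˡ : ∀ n k (F : Vector (Fin d) n → ℕ) → ∑-vectors n (λ c → k * F c) ≡ k * ∑-vectors n F
  ∑-vectors-*ˡ zero    k F = refl
  ∑-vectors-*ˡ (suc n) k F = begin
    ∑[ x < d ] ∑-vectors n (λ c → k * F (x Vector.∷ c))
      ≡⟨ sum-cong-≗ {d} (λ x → ∑-vectors-*ˡ n k (λ c → F (x Vector.∷ c))) ⟩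
    ∑[ x < d ] (k * ∑-vectors n (λ c → F (x Vector.∷ c)))
      ≡⟨ *-distribˡ-sum k (λ x → ∑-vectors n (λ c → F (x Vector.∷ c))) ⟨
    k * (∑[ x < d ] ∑-vectors n (λ c → F (x Vector.∷ c))) ∎
    where open ≡-Reasoning

  ∑-vectors-∑ : ∀ n {m} (F : Fin m → Vector (Fin d) n → ℕ) →
                ∑-vectors n (λ c → ∑[ i < m ] F i c) ≡ ∑[ i < m ] ∑-vectors n (F i)
  ∑-vectors-∑ zero        F = refl
  ∑-vectors-∑ (suc n) {m} F = begin
    ∑[ x < d ] ∑-vectors n (λ c → ∑[ i < m ] F i (x Vector.∷ c))
      ≡⟨ sum-cong-≗ {d} (λ x → ∑-vectors-∑ n (λ i c → F i (x Vector.∷ c))) ⟩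
    ∑[ x < d ] ∑[ i < m ] ∑-vectors n (λ c → F i (x Vector.∷ c))
      ≡⟨ ∑-comm (λ x i → ∑-vectors n (λ c → F i (x Vector.∷ c))) ⟩
    ∑[ i < m ] ∑[ x < d ] ∑-vectors n (λ c → F i (x Vector.∷ c)) ∎
    where open ≡-Reasoning

  ∑-vectors-product : ∀ n (h : Fin n → Fin d → ℕ) →
                      ∑-vectors n (λ c → product (λ w → h w (c w))) ≡ product (λ w → ∑[ y < d ] h w y)
  ∑-vectors-product zero    h = refl
  ∑-vectors-product (suc n) h = begin
    ∑[ x < d ] ∑-vectors n (λ c → h zero x * product (λ w → h (suc w) (c w)))
      ≡⟨ sum-cong-≗ (λ x → ∑-vectors-*ˡ n (h zero x) (λ c → product (λ w → h (suc w) (c w)))) ⟩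
    ∑[ x < d ] (h zero x * ∑-vectors n (λ c → product (λ w → h (suc w) (c w))))
      ≡⟨ sum-cong-≗ (λ x → cong (h zero x *_) (∑-vectors-product n (h ∘ suc))) ⟩
    ∑[ x < d ] (h zero x * product (λ w → ∑[ y < d ] h (suc w) y))
      ≡⟨ *-distribʳ-sum (product (λ w → ∑[ y < d ] h (suc w) y)) (h zero) ⟨
    ∑[ y < d ] h zero y * product (λ w → ∑[ y < d ] h (suc w) y) ∎
    where open ≡-Reasoning

Unique⇒lookup-injective : ∀ {A : Set} {xs : List A} → Unique xs → Injective _≡_ _≡_ (lookup xs)
Unique⇒lookup-injective (_ ∷ _)    {zero}  {zero}  _  = refl
Unique⇒lookup-injective (x∉ ∷ _)   {zero}  {suc j} eq = contradiction eq (All.lookup x∉ (∈-lookup j))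
Unique⇒lookup-injective (x∉ ∷ _)   {suc i} {zero}  eq = contradiction (sym eq) (All.lookup x∉ (∈-lookup i))
Unique⇒lookup-injective (_ ∷ uniq) {suc i} {suc j} eq = cong suc (Unique⇒lookup-injective uniq eq)

Unique⇒length≤ : ∀ {n} {xs : List (Fin n)} → Unique xs → length xs ≤ n
Unique⇒length≤ uniq = injective⇒≤ (Unique⇒lookup-injective uniq)

Unique-∷ʳ : ∀ {A : Set} {xs : List A} {x} → Unique xs → x ∉ xs → Unique (xs ++ [ x ])
Unique-∷ʳ uniq x∉ = ++⁺ uniq (All.[] ∷ []) λ { (x∈ , here refl) → x∉ x∈ }

data Walk {n} (R : Fin n → Fin n → Set) : Fin n → List (Fin n) → Fin n → Set where
  []  : ∀ {u} → Walk R u [] u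
  _∷_ : ∀ {u w ws e} → R u w → Walk R w ws e → Walk R u (w ∷ ws) e

SimpleCycle : ∀ {n} → (Fin n → Fin n → Set) → Set
SimpleCycle R = ∃₂ λ v₀ vs → IsCycle v₀ vs × Walk R v₀ (vs ++ [ v₀ ]) v₀

module _ {n} {R : Fin n → Fin n → Set} where

  open import Data.List.Membership.DecPropositional (_≟_ {n}) using (_∈?_)

  walk-∷ʳ : ∀ {u vs e w} → Walk R u vs e → R e w → Walk R u (vs ++ [ w ]) w
  walk-∷ʳ []      r = r ∷ []
  walk-∷ʳ (s ∷ p) r = s ∷ walk-∷ʳ p r

  walk-from : ∀ {u vs e w} → Walk R u vs e → w ∈ u ∷ vs →
              ∃ λ zs → Walk R w zs e × (Unique (u ∷ vs) → Unique (w ∷ zs))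
  walk-from p       (here refl) = _ , p , id
  walk-from (_ ∷ p) (there w∈)  with walk-from p w∈
  ... | zs , q , suffix-unique = zs , q , λ { (_ ∷ uniq) → suffix-unique uniq }

  module _ (R-irrefl : ∀ {u} → ¬ R u u) (R-serial : ∀ u → ∃ (R u)) where

    close-walk : ∀ {w zs e} → Walk R w zs e → R e w → Unique (w ∷ zs) → SimpleCycle R
    close-walk []        r _    = contradiction r R-irrefl
    close-walk p@(_ ∷ _) r uniq = _ , _ , (uniq , s≤s z≤n) , walk-∷ʳ p r

    -- The fuel k never runs out: a simple walk in Fin n has at most n vertices.
    extend-walk : ∀ k {v₀ vs e} → n ≤ k + length vs → Walk R v₀ vs e → Unique (v₀ ∷ vs) → SimpleCycle R
    extend-walk zero    n≤ _ uniq = contradiction (Unique⇒length≤ uniq) (<⇒≱ (s≤s n≤))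
    extend-walk (suc k) {v₀} {vs} {e} n≤ p uniq = continue (R-serial e)
      where
      continue : ∃ (R e) → SimpleCycle R
      continue (w , r) with w ∈? v₀ ∷ vs
      ... | yes w∈ = let zs , q , suffix-unique = walk-from p w∈ in close-walk q r (suffix-unique uniq)
      ... | no  w∉ = extend-walk k (subst (n ≤_) (sym fuel) n≤) (walk-∷ʳ p r) (Unique-∷ʳ uniq w∉)
        where
        fuel : k + length (vs ++ [ w ]) ≡ suc k + length vs
        fuel = trans (cong (k +_) (trans (length-++ vs) (+-comm (length vs) 1))) (+-suc k (length vs))

    simpleCycle : Fin n → SimpleCycle R
    simpleCycle u = extend-walk n {u} (m≤m+n n 0) [] (All.[] ∷ [])

module _ {d n} (lab : Labeling d n) (c : Vector (Fin d) n) where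

  Consistent : Fin n → Fin n → Set
  Consistent u w = u ≢ w × lab u w (c u) ≡ c w

  Sink : Fin n → Set
  Sink u = ∀ w → ¬ Consistent u w

  walk-pathMap : ∀ {u ws e} → Walk Consistent u ws e → pathMap lab u ws (c u) ≡ c e
  walk-pathMap []                                = refl
  walk-pathMap (_∷_ {w = w} {ws = ws} (_ , eq) p) = trans (cong (pathMap lab w ws) eq) (walk-pathMap p)

  consistent? : ∀ u w → Dec (Consistent u w)
  consistent? u w = ¬? (u ≟ w) ×-dec (lab u w (c u) ≟ c w)

  consistentCycle⇒¬FixedPointFree : SimpleCycle Consistent → ¬ FixedPointFree lab
  consistentCycle⇒¬FixedPointFree (v₀ , vs , isCycle , closed) fpf =
    fpf v₀ vs (isCycle , c v₀ , walk-pathMap closed)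

  sink-exists : FixedPointFree lab → Fin n → ∃ Sink
  sink-exists fpf u₀ with all? (λ u → any? (consistent? u))
  ... | yes serial = contradiction fpf (consistentCycle⇒¬FixedPointFree (simpleCycle irrefl serial u₀))
    where
    irrefl : ∀ {u} → ¬ Consistent u u
    irrefl (u≢u , _) = u≢u refl
  ... | no ¬serial with ¬∀⟶∃¬ n _ (λ u → any? (consistent? u)) ¬serial
  ...   | u , no-out-edge = u , λ w consistent → no-out-edge (w , consistent)

module _ {a n} (lab : Labeling (suc a) n) where

  -- sinkWeight u c is 1 if u is a sink of c and 0 otherwise.  Summing over the colour x of u
  -- turns it into a sum of products of one factor per vertex, which can be summed over all c
  -- one coordinate at a time.
  admissible : Fin n → Fin (suc a) → Fin n → Fin (suc a) → ℕ
  admissible u x w y = if does (w ≟ u) then 𝟙 (y ≟ x) else 𝟙 (¬? (y ≟ lab u w x))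

  sinkWeight : Fin n → Vector (Fin (suc a)) n → ℕ
  sinkWeight u c = ∑[ x < suc a ] product (λ w → admissible u x w (c w))

  sink⇒1≤sinkWeight : ∀ c u → Sink lab c u → 1 ≤ sinkWeight u c
  sink⇒1≤sinkWeight c u sink =
    ≤-trans (1≤product _ admissible-c) (≤-sum (λ x → product (λ w → admissible u x w (c w))) (c u))
    where
    admissible-c : ∀ w → 1 ≤ admissible u (c u) w (c w)
    admissible-c w with w ≟ u
    ... | yes refl = 1≤𝟙 (c u ≟ c u) refl
    ... | no  w≢u  = 1≤𝟙 (¬? (c w ≟ lab u w (c u))) (λ eq → sink w ((λ u≡w → w≢u (sym u≡w)) , sym eq))

  ∑-admissible : ∀ u x w → ∑[ y < suc a ] admissible u x w y ≡ (if does (w ≟ u) then 1 else a)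
  ∑-admissible u x w with w ≟ u
  ... | yes _ = ∑-𝟙≡ x
  ... | no  _ = ∑-𝟙≢ (lab u w x)

  ∑-sinkWeight : ∀ u → ∑-vectors n (sinkWeight u) ≡ suc a * a ^ pred n
  ∑-sinkWeight u = begin
    ∑-vectors n (λ c → ∑[ x < suc a ] product (λ w → admissible u x w (c w)))
      ≡⟨ ∑-vectors-∑ n (λ x c → product (λ w → admissible u x w (c w))) ⟩
    ∑[ x < suc a ] ∑-vectors n (λ c → product (λ w → admissible u x w (c w)))
      ≡⟨ sum-cong-≗ (λ x → ∑-vectors-product n (admissible u x)) ⟩
    ∑[ x < suc a ] product (λ w → ∑[ y < suc a ] admissible u x w y)
      ≡⟨ sum-cong-≗ (λ x → product-cong-≗ (∑-admissible u x)) ⟩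
    ∑[ x < suc a ] product (λ w → if does (w ≟ u) then 1 else a)
      ≡⟨ sum-cong-≗ {suc a} (λ _ → product-except u a) ⟩
    ∑[ x < suc a ] (a ^ pred n)
      ≡⟨ sum-const (suc a) (a ^ pred n) ⟩
    suc a * a ^ pred n ∎
    where open ≡-Reasoning

  colourings≤sinks : FixedPointFree lab → Fin n → suc a ^ n ≤ n * (suc a * a ^ pred n)
  colourings≤sinks fpf u₀ = begin
    suc a ^ n                                      ≡⟨ ∑-vectors-1 n ⟨
    ∑-vectors n (λ _ → 1)                          ≤⟨ ∑-vectors-mono n some-sink ⟩
    ∑-vectors n (λ c → ∑[ u < n ] sinkWeight u c)  ≡⟨ ∑-vectors-∑ n sinkWeight ⟩
    ∑[ u < n ] ∑-vectors n (sinkWeight u)          ≡⟨ sum-cong-≗ ∑-sinkWeight ⟩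
    ∑[ u < n ] (suc a * a ^ pred n)                ≡⟨ sum-const n (suc a * a ^ pred n) ⟩
    n * (suc a * a ^ pred n)                       ∎
    where
    open ≤-Reasoning
    some-sink : ∀ c → 1 ≤ ∑[ u < n ] sinkWeight u c
    some-sink c with sink-exists lab c fpf u₀
    ... | u , sink = ≤-trans (sink⇒1≤sinkWeight c u sink) (≤-sum (λ u → sinkWeight u c) u)

bernoulli : ∀ a k → a ^ k * (a + k) ≤ suc a ^ k * a
bernoulli a zero    = ≤-reflexive (cong (1 *_) (+-identityʳ a))
bernoulli a (suc k) = begin
  a ^ suc k * (a + suc k)                   ≡⟨ expand (a ^ k) a k ⟩
  a * (a ^ k * (a + k)) + a ^ k * a         ≤⟨ +-monoʳ-≤ _ (*-monoʳ-≤ (a ^ k) (m≤m+n a k)) ⟩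
  a * (a ^ k * (a + k)) + a ^ k * (a + k)   ≡⟨ collect (a ^ k * (a + k)) a ⟩
  suc a * (a ^ k * (a + k))                 ≤⟨ *-monoʳ-≤ (suc a) (bernoulli a k) ⟩
  suc a * (suc a ^ k * a)                   ≡⟨ *-assoc (suc a) (suc a ^ k) a ⟨
  suc a ^ suc k * a                         ∎
  where
  open ≤-Reasoning
  expand : ∀ p a k → a * p * (a + suc k) ≡ a * (p * (a + k)) + p * a
  expand = solve-∀
  collect : ∀ q a → a * q + q ≡ suc a * q
  collect = solve-∀

2*a^a≤[1+a]^a : ∀ a .{{_ : NonZero a}} → 2 * a ^ a ≤ suc a ^ a
2*a^a≤[1+a]^a a = *-cancelʳ-≤ _ _ a (begin
  2 * a ^ a * a      ≡⟨ double (a ^ a) a ⟩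
  a ^ a * (a + a)    ≤⟨ bernoulli a a ⟩
  suc a ^ a * a      ∎)
  where
  open ≤-Reasoning
  double : ∀ p a → 2 * p * a ≡ p * (a + a)
  double = solve-∀

x*y≤z⇒x^j*y^j≤z^j : ∀ {x y z} j → x * y ≤ z → x ^ j * y ^ j ≤ z ^ j
x*y≤z⇒x^j*y^j≤z^j         zero    _    = ≤-refl
x*y≤z⇒x^j*y^j≤z^j {x} {y} (suc j) xy≤z = begin
  x * x ^ j * (y * y ^ j)       ≡⟨ regroup x y (x ^ j) (y ^ j) ⟩
  x * y * (x ^ j * y ^ j)       ≤⟨ *-mono-≤ xy≤z (x*y≤z⇒x^j*y^j≤z^j j xy≤z) ⟩
  _                             ∎
  where
  open ≤-Reasoning
  regroup : ∀ x y p q → x * p * (y * q) ≡ x * y * (p * q)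
  regroup = solve-∀

2^j*a^[a*j]≤[1+a]^[a*j] : ∀ a .{{_ : NonZero a}} j → 2 ^ j * a ^ (a * j) ≤ suc a ^ (a * j)
2^j*a^[a*j]≤[1+a]^[a*j] a j = begin
  2 ^ j * a ^ (a * j)      ≡⟨ cong (2 ^ j *_) (^-*-assoc a a j) ⟨
  2 ^ j * (a ^ a) ^ j      ≤⟨ x*y≤z⇒x^j*y^j≤z^j j (2*a^a≤[1+a]^a a) ⟩
  (suc a ^ a) ^ j          ≡⟨ ^-*-assoc (suc a) a j ⟩
  suc a ^ (a * j)          ∎
  where open ≤-Reasoning

[1+a]²<2^[2+a] : ∀ a → suc a * suc a < 2 ^ (2 + a)
[1+a]²<2^[2+a] 0 = from-yes (1 <? 4)
[1+a]²<2^[2+a] 1 = from-yes (4 <? 8)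
[1+a]²<2^[2+a] 2 = from-yes (9 <? 16)
[1+a]²<2^[2+a] (suc a@(suc (suc b))) = begin-strict
  suc (suc a) * suc (suc a)                         ≤⟨ m≤m+n _ (b * b + 4 * b + 2) ⟩
  suc (suc a) * suc (suc a) + (b * b + 4 * b + 2)   ≡⟨ square-step b ⟩
  2 * (suc a * suc a)                               <⟨ *-monoʳ-< 2 ([1+a]²<2^[2+a] a) ⟩
  2 ^ (2 + suc a)                                   ∎
  where
  open ≤-Reasoning
  square-step : ∀ b → let a = suc (suc b) in
                suc (suc a) * suc (suc a) + (b * b + 4 * b + 2) ≡ 2 * (suc a * suc a)
  square-step = solve-∀

-- (1 + 1/a)^m > m + 1, with the denominators cleared.
Outgrows : ℕ → ℕ → Set
Outgrows a m = suc m * a ^ m < suc a ^ m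

outgrows-suc : ∀ a m → a ≤ suc m → Outgrows a m → Outgrows a (suc m)
outgrows-suc a m a≤1+m outgrows = begin-strict
  suc (suc m) * a ^ suc m      ≡⟨ peel (suc m) a (a ^ m) ⟩
  (suc m * a + a) * a ^ m      ≤⟨ *-monoˡ-≤ (a ^ m) (+-monoʳ-≤ (suc m * a) a≤1+m) ⟩
  (suc m * a + suc m) * a ^ m  ≡⟨ regroup (suc m) a (a ^ m) ⟩
  suc a * (suc m * a ^ m)      <⟨ *-monoʳ-< (suc a) outgrows ⟩
  suc a ^ suc m                ∎
  where
  open ≤-Reasoning
  peel : ∀ s a p → suc s * (a * p) ≡ (s * a + a) * p
  peel = solve-∀
  regroup : ∀ s a p → (s * a + s) * p ≡ suc a * (s * p)
  regroup = solve-∀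

outgrows-a[2+a] : ∀ a .{{_ : NonZero a}} → Outgrows a (a * (2 + a))
outgrows-a[2+a] a = begin-strict
  suc (a * (2 + a)) * a ^ (a * (2 + a))  ≡⟨ cong (_* a ^ (a * (2 + a))) (square a) ⟩
  suc a * suc a * a ^ (a * (2 + a))      <⟨ *-monoˡ-< (a ^ (a * (2 + a))) {{m^n≢0 a (a * (2 + a))}} ([1+a]²<2^[2+a] a) ⟩
  2 ^ (2 + a) * a ^ (a * (2 + a))        ≤⟨ 2^j*a^[a*j]≤[1+a]^[a*j] a (2 + a) ⟩
  suc a ^ (a * (2 + a))                  ∎
  where
  open ≤-Reasoning
  square : ∀ a → suc (a * (2 + a)) ≡ suc a * suc a
  square = solve-∀

outgrows-beyond : ∀ a .{{_ : NonZero a}} {m} → a * (2 + a) ≤′ m → Outgrows a m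
outgrows-beyond a ≤′-refl = outgrows-a[2+a] a
outgrows-beyond a {suc m} (≤′-step M≤′m) =
  outgrows-suc a m (≤-trans (m≤m*n a (2 + a)) (≤-trans (≤′⇒≤ M≤′m) (n≤1+n m))) (outgrows-beyond a M≤′m)

[1+a]^m≤[1+m]a^m⇒1+m≤[1+a]² : ∀ a m → suc a ^ m ≤ suc m * a ^ m → suc m ≤ suc a ^ 2
[1+a]^m≤[1+m]a^m⇒1+m≤[1+a]² zero    zero    _ = ≤-refl
[1+a]^m≤[1+m]a^m⇒1+m≤[1+a]² zero    (suc m) h =
  contradiction (≤-trans (m^n>0 1 (suc m)) (≤-trans h (≤-reflexive (*-zeroʳ (suc (suc m)))))) λ ()
[1+a]^m≤[1+m]a^m⇒1+m≤[1+a]² a@(suc _) m h = begin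
  suc m                  ≤⟨ ≰⇒> (λ M≤m → <⇒≱ (outgrows-beyond a (≤⇒≤′ M≤m)) h) ⟩
  a * (2 + a)            ≤⟨ n≤1+n _ ⟩
  suc (a * (2 + a))      ≡⟨ square a ⟩
  suc a ^ 2              ∎
  where
  open ≤-Reasoning
  square : ∀ a → suc (a * (2 + a)) ≡ suc a * (suc a * 1)
  square = solve-∀

fixedPointFree⇒n≤d² : ∀ {d n} (lab : Labeling d n) → 1 ≤ d → FixedPointFree lab → n ≤ d ^ 2
fixedPointFree⇒n≤d² {suc a} {zero}  _   _ _   = z≤n
fixedPointFree⇒n≤d² {suc a} {suc m} lab _ fpf =
  [1+a]^m≤[1+m]a^m⇒1+m≤[1+a]² a m (*-cancelˡ-≤ (suc a) (begin
    suc a * suc a ^ m         ≤⟨ colourings≤sinks lab fpf zero ⟩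
    suc m * (suc a * a ^ m)   ≡⟨ swap (suc m) (suc a) (a ^ m) ⟩
    suc a * (suc m * a ^ m)   ∎))
  where
  open ≤-Reasoning
  swap : ∀ x y z → x * (y * z) ≡ y * (x * z)
  swap = solve-∀

n≤d²⇒n^k≤d^[2k+1] : ∀ {n d} k → 1 ≤ d → n ≤ d ^ 2 → n ^ k ≤ d ^ (2 * k + 1)
n≤d²⇒n^k≤d^[2k+1] {n} {d} k 1≤d n≤d² = begin
  n ^ k            ≤⟨ ^-monoˡ-≤ k n≤d² ⟩
  (d ^ 2) ^ k      ≡⟨ ^-*-assoc d 2 k ⟩
  d ^ (2 * k)      ≤⟨ ^-monoʳ-≤ d {{>-nonZero 1≤d}} (m≤m+n (2 * k) 1) ⟩
  d ^ (2 * k + 1)  ∎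
  where open ≤-Reasoning

theorem2 :
    -- (i) R_f(d) is finite for every d > 0
    (∀ (d : ℕ) → 1 ≤ d → Σ ℕ (λ B → ∀ (n : ℕ) (lab : Labeling d n) → FixedPointFree lab → n ≤ B))
    -- (ii) R_f(1) ≤ 1 = 1^(2+ε(1))
    × (∀ (n : ℕ) (lab : Labeling 1 n) → FixedPointFree lab → n ≤ 1)
    -- (iii) for every δ = 1/k there is D with R_f(d) ≤ d^(2+1/k) for all d ≥ D
    × (∀ (k : ℕ) → 1 ≤ k → Σ ℕ (λ D → ∀ (d : ℕ) → D ≤ d → ∀ (n : ℕ) (lab : Labeling d n) →
        FixedPointFree lab → n ^ k ≤ d ^ (2 * k + 1)))
theorem2 =
    (λ d 1≤d → d ^ 2 , λ n lab → fixedPointFree⇒n≤d² lab 1≤d)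
  , (λ n lab → fixedPointFree⇒n≤d² lab ≤-refl)
  , (λ k _ → 1 , λ d 1≤d n lab fpf → n≤d²⇒n^k≤d^[2k+1] k 1≤d (fixedPointFree⇒n≤d² lab 1≤d fpf))
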